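{- Let $t\geq 4$ and let $G$ be a disconnected $K^2_t$-saturated graph of order $n$ with connected components $G_1,\dots,G_l$, $l\geq 2$. Then (after relabeling) $G\cong G_1\cup (l-1)K_{t+1}$, where $G_1$ is either a $K^2_t$-saturated graph or isomorphic to $K_f$ for some $1\leq f\leq t+1$.
   Context: All graphs are finite and simple; $\cup$ is disjoint union, $kG$ is the disjoint union of $k$ copies of $G$, $K_m$ the complete graph. For $t\ge3$, the virus $K^2_t$ is the graph on $t+2$ vertices obtained from $K_t$ by attaching one pendant vertex to each of two distinct vertices of $K_t$. A graph $G$ is $K^2_t$-saturated if it contains no subgraph isomorphic to $K^2_t$ but $G+uv$ contains one for every pair of non-adjacent vertices $u,v$; a graph with fewer than $t+2$ vertices is not $K^2_t$-saturated by convention. -}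

module Defs where

open import Data.Nat using (ℕ; zero; suc; _+_; _∸_; _≤_; _<_)
open import Data.Fin using (Fin; toℕ)
import Data.Fin as Fin
open import Data.Product using (Σ; ∃; _×_; _,_; proj₁; proj₂)
open import Data.Sum using (_⊎_; inj₁; inj₂)
open import Data.Empty using (⊥)
open import Relation.Nullary using (¬_; Dec; yes; no)
open import Relation.Nullary.Decidable using (_×-dec_; ¬?)
open import Relation.Binary.PropositionalEquality using (_≡_; _≢_; refl; sym)
open import Function.Bundles using (Inverse; _⇔_; _↔_)
open import Function.Definitions using (Injective)

record Graph (V : Set) : Set₁ where
  field
    Adj    : V → V → Set
    adj-sym : ∀ {x y} → Adj x y → Adj y x
    irrefl : ∀ x → ¬ Adj x x
    adj?   : ∀ x y → Dec (Adj x y)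
open Graph public

-- Adjacency of the virus K^2_t on vertex set Fin (t+2):
-- vertices 0..t-1 form K_t, vertex t is pendant at 0, vertex t+1 is pendant at 1.
VirusAdj : (t : ℕ) → Fin (suc (suc t)) → Fin (suc (suc t)) → Set
VirusAdj t i j =
    (toℕ i < t × toℕ j < t × toℕ i ≢ toℕ j)
  ⊎ (toℕ i ≡ t × toℕ j ≡ 0) ⊎ (toℕ i ≡ 0 × toℕ j ≡ t)
  ⊎ (toℕ i ≡ suc t × toℕ j ≡ 1) ⊎ (toℕ i ≡ 1 × toℕ j ≡ suc t)

ContainsVirus : (t : ℕ) {V : Set} → (V → V → Set) → Set
ContainsVirus t {V} R =
  Σ (Fin (suc (suc t)) → V) λ f →
    Injective _≡_ _≡_ f × (∀ i j → VirusAdj t i j → R (f i) (f j))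

AddEdge : {V : Set} → (V → V → Set) → V → V → (V → V → Set)
AddEdge R u v x y = R x y ⊎ (x ≡ u × y ≡ v) ⊎ (x ≡ v × y ≡ u)

-- K^2_t-saturated graph of order n (graphs with fewer than t+2 vertices are
-- not saturated by convention).
Saturated : (t : ℕ) {n : ℕ} → Graph (Fin n) → Set
Saturated t {n} G =
  suc (suc t) ≤ n
  × ¬ ContainsVirus t (Adj G)
  × (∀ u v → u ≢ v → ¬ Adj G u v → ContainsVirus t (AddEdge (Adj G) u v))

data Reach {V : Set} (G : Graph V) : V → V → Set where
  here : ∀ {u} → Reach G u u
  step : ∀ {u w v} → Adj G u w → Reach G w v → Reach G u v

Connected : {m : ℕ} → Graph (Fin m) → Set
Connected {m} G = 1 ≤ m × (∀ u v → Reach G u v)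

Complete : (m : ℕ) → Graph (Fin m)
Complete m = record
  { Adj = λ x y → x ≢ y
  ; adj-sym = λ p q → p (sym q)
  ; irrefl = λ x p → p refl
  ; adj? = λ x y → ¬? (x Fin.≟ y) }

Copies : (k : ℕ) {V : Set} → Graph V → Graph (Fin k × V)
Copies k G = record
  { Adj = λ p q → proj₁ p ≡ proj₁ q × Adj G (proj₂ p) (proj₂ q)
  ; adj-sym = λ { (e , a) → sym e , adj-sym G a }
  ; irrefl = λ p q → irrefl G (proj₂ p) (proj₂ q)
  ; adj? = λ p q → (proj₁ p Fin.≟ proj₁ q) ×-dec adj? G (proj₂ p) (proj₂ q) }

UAdj : {V W : Set} → Graph V → Graph W → V ⊎ W → V ⊎ W → Set
UAdj G H (inj₁ a) (inj₁ b) = Adj G a b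
UAdj G H (inj₂ a) (inj₂ b) = Adj H a b
UAdj G H (inj₁ a) (inj₂ b) = ⊥
UAdj G H (inj₂ a) (inj₁ b) = ⊥

private
  usym : {V W : Set} (G : Graph V) (H : Graph W) → ∀ {x y} → UAdj G H x y → UAdj G H y x
  usym G H {inj₁ a} {inj₁ b} e = adj-sym G e
  usym G H {inj₂ a} {inj₂ b} e = adj-sym H e
  usym G H {inj₁ a} {inj₂ b} ()
  usym G H {inj₂ a} {inj₁ b} ()

  uirr : {V W : Set} (G : Graph V) (H : Graph W) → ∀ x → ¬ UAdj G H x x
  uirr G H (inj₁ a) = irrefl G a
  uirr G H (inj₂ a) = irrefl H a

  udec : {V W : Set} (G : Graph V) (H : Graph W) → ∀ x y → Dec (UAdj G H x y)
  udec G H (inj₁ a) (inj₁ b) = adj? G a b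
  udec G H (inj₂ a) (inj₂ b) = adj? H a b
  udec G H (inj₁ a) (inj₂ b) = no (λ ())
  udec G H (inj₂ a) (inj₁ b) = no (λ ())

_∪_ : {V W : Set} → Graph V → Graph W → Graph (V ⊎ W)
G ∪ H = record { Adj = UAdj G H ; adj-sym = λ {x} {y} → usym G H {x} {y} ; irrefl = uirr G H ; adj? = udec G H }

_≅_ : {V W : Set} → Graph V → Graph W → Set
_≅_ {V} {W} G H =
  Σ (V ↔ W) λ φ →
    ∀ x y → Adj G x y ⇔ Adj H (Inverse.to φ x) (Inverse.to φ y)

HasComponents : {n : ℕ} → Graph (Fin n) → ℕ → Set
HasComponents {n} G l =
  Σ (Fin n → Fin l) λ c →
    (∀ i → ∃ λ v → c v ≡ i) × (∀ u v → (c u ≡ c v) ⇔ Reach G u v)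

-- Call x a pendant-clique vertex if it lies on a copy of K_t with a pendant edge at another of its
-- vertices. If u and v lie in different components, a virus in G + uv must use uv as a pendant edge
-- (inside its K_t, uv would give u and v a common neighbour), so u or v is a pendant-clique vertex.
-- Hence at most one component contains a vertex that is not a pendant-clique vertex.
-- Every component other than K_{t+1} contains one. A complete component has at most t+1 vertices,
-- as K_{t+2} contains the virus, while a pendant-clique vertex has t+1 vertices in its component.
-- Otherwise adding a missing edge creates a virus inside the component, so it has t+2 vertices. Given
-- a clique S with pendant edge yz, two distinct pendants at distinct vertices of S would form a virus.
-- So either y has a second pendant and is then the only exit from S - y, or z is the only exit from S
-- and, the component being larger than S + z, leads further. In both cases the exit vertex, having
-- neighbours on both sides, is not a pendant-clique vertex.
-- So all components but one are copies of K_{t+1}; the last is saturated unless it is complete.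

module Submission where

open import Defs
open import Data.Nat using (ℕ; zero; suc; >-nonZero⁻¹; _∸_; _≤_; _<_; z≤n; s≤s)
import Data.Nat.Properties as ℕ
open import Data.Fin using (Fin; zero; suc; toℕ; fromℕ<; inject₁; fromℕ; inject≤; punchIn; punchOut)
open import Data.Fin.Properties
  using (_≟_; any?; all?; ¬∀⟶∃¬; injective⇒≤; nonZeroIndex; suc-injective; toℕ-injective; toℕ<n; toℕ-fromℕ<;
         toℕ-inject₁; toℕ-fromℕ; fromℕ≢inject₁; inject≤-injective; punchIn-punchOut; punchInᵢ≢i; punchOut-cong;
         punchOut-punchIn)
open import Data.Fin.Permutation using (Permutation′; insert; id; _⟨$⟩ʳ_)
open import Data.Product using (Σ; ∃; ∃₂; _×_; _,_; proj₁; proj₂)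
open import Data.Sum using (_⊎_; inj₁; inj₂; [_,_])
open import Data.Empty using (⊥; ⊥-elim)
open import Function using (_∘_)
open import Function.Bundles using (Injection; Equivalence; _⇔_; mk⇔; mk↔ₛ′)
open import Function.Definitions using (Injective)
open import Function.Construct.Identity using (↔-id)
open import Function.Properties.Inverse using (↔⇒↣)
open import Relation.Nullary using (¬_; Dec; yes; no)
open import Relation.Nullary.Decidable using (_×-dec_; _→-dec_; ¬?; decidable-stable)
open import Relation.Unary using (Decidable)
open import Relation.Binary using (tri<; tri≈; tri>)
open import Relation.Binary.PropositionalEquality
  using (_≡_; _≢_; refl; sym; trans; cong; cong₂; subst; subst₂)

record Enumeration {n : ℕ} (P : Fin n → Set) (m : ℕ) : Set where
  field
    at           : Fin m → Fin n
    at-satisfies : ∀ k → P (at k)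
    at-injective : Injective _≡_ _≡_ at
    index        : ∀ v → P v → Fin m
    at-index     : ∀ v p → at (index v p) ≡ v

  index-at : ∀ k p → index (at k) p ≡ k
  index-at k p = at-injective (at-index (at k) p)

module _ {n m : ℕ} {P : Fin (suc n) → Set} (E : Enumeration (P ∘ suc) m) where
  open Enumeration E

  enumerate-with-zero : P zero → Enumeration P (suc m)
  enumerate-with-zero p₀ = record
    { at = at′ ; at-satisfies = at′-satisfies ; at-injective = at′-injective
    ; index = index′ ; at-index = at′-index }
    where
    at′ : Fin (suc m) → Fin (suc n)
    at′ zero    = zero
    at′ (suc k) = suc (at k)

    at′-satisfies : ∀ k → P (at′ k)
    at′-satisfies zero    = p₀
    at′-satisfies (suc k) = at-satisfies k

    at′-injective : Injective _≡_ _≡_ at′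
    at′-injective {zero}  {zero}  _  = refl
    at′-injective {suc _} {suc _} eq = cong suc (at-injective (suc-injective eq))

    index′ : ∀ v → P v → Fin (suc m)
    index′ zero    _ = zero
    index′ (suc v) p = suc (index v p)

    at′-index : ∀ v p → at′ (index′ v p) ≡ v
    at′-index zero    _ = refl
    at′-index (suc v) p = cong suc (at-index v p)

  enumerate-without-zero : ¬ P zero → Enumeration P m
  enumerate-without-zero ¬p₀ = record
    { at = suc ∘ at ; at-satisfies = at-satisfies ; at-injective = at-injective ∘ suc-injective
    ; index = index′ ; at-index = at′-index }
    where
    index′ : ∀ v → P v → Fin m
    index′ zero    p = ⊥-elim (¬p₀ p)
    index′ (suc v) p = index v p

    at′-index : ∀ v p → suc (at (index′ v p)) ≡ v
    at′-index zero    p = ⊥-elim (¬p₀ p)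
    at′-index (suc v) p = cong suc (at-index v p)

enumerate : ∀ {n} {P : Fin n → Set} → Decidable P → ∃ (Enumeration P)
enumerate {zero} P? = 0 , record
  { at = λ () ; at-satisfies = λ () ; at-injective = λ { {()} } ; index = λ () ; at-index = λ () }
enumerate {suc n} P? with enumerate (P? ∘ suc) | P? zero
... | m , E | yes p₀ = suc m , enumerate-with-zero E p₀
... | m , E | no ¬p₀ = m , enumerate-without-zero E ¬p₀

outside-image : ∀ {m n N} (h : Fin m → Fin N) (g : Fin n → Fin N) → Injective _≡_ _≡_ g → m < n →
                ∃ λ k → ∀ r → h r ≢ g k
outside-image {m} h g g-injective m<n with any? (λ k → all? (λ r → ¬? (h r ≟ g k)))
... | yes found = found
... | no none = ⊥-elim (ℕ.<⇒≱ m<n (injective⇒≤ preimage-injective))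
  where
  preimage : ∀ k → ∃ λ r → h r ≡ g k
  preimage k with ¬∀⟶∃¬ m _ (λ r → ¬? (h r ≟ g k)) (λ avoids → none (k , avoids))
  ... | r , ¬¬eq = r , decidable-stable (h r ≟ g k) ¬¬eq

  preimage-injective : Injective _≡_ _≡_ (proj₁ ∘ preimage)
  preimage-injective {k} {k′} eq =
    g-injective (trans (sym (proj₂ (preimage k))) (trans (cong h eq) (proj₂ (preimage k′))))

all-but-one : ∀ {L} {P : Fin (suc L) → Set} → Decidable P → (∀ i j → i ≢ j → ¬ P i → ¬ P j → ⊥) →
              ∃ λ i₀ → ∀ j → j ≢ i₀ → P j
all-but-one P? unique-failure with any? (¬? ∘ P?)
... | yes (i₀ , ¬Pi₀) = i₀ , λ j j≢i₀ → decidable-stable (P? j) (λ ¬Pj → unique-failure j i₀ j≢i₀ ¬Pj ¬Pi₀)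
... | no no-failure = zero , λ j _ → decidable-stable (P? j) (λ ¬Pj → no-failure (j , ¬Pj))

induced : ∀ {V W : Set} → (W → V) → Graph V → Graph W
induced e G = record
  { Adj = λ a b → Adj G (e a) (e b) ; adj-sym = adj-sym G ; irrefl = irrefl G ∘ e
  ; adj? = λ a b → adj? G (e a) (e b) }

IsComplete : ∀ {V} → Graph V → Set
IsComplete G = ∀ a b → a ≢ b → Adj G a b

complete? : ∀ {m} (H : Graph (Fin m)) → Dec (IsComplete H)
complete? H = all? λ a → all? λ b → ¬? (a ≟ b) →-dec adj? H a b

nonadjacent-pair : ∀ {m} (H : Graph (Fin m)) → ¬ IsComplete H → ∃₂ λ a b → a ≢ b × ¬ Adj H a b
nonadjacent-pair {m} H incomplete with ¬∀⟶∃¬ m _ (λ a → all? λ b → ¬? (a ≟ b) →-dec adj? H a b) incomplete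
... | a , ¬all with ¬∀⟶∃¬ m _ (λ b → ¬? (a ≟ b) →-dec adj? H a b) ¬all
... | b , ¬impl = a , b , (λ a≡b → ¬impl λ a≢b → ⊥-elim (a≢b a≡b)) , (λ adj → ¬impl λ _ → adj)

walk-exit : ∀ {V} (G : Graph V) {T : V → Set} → Decidable T → ∀ {u v} → Reach G u v → T u → ¬ T v →
            ∃₂ λ p q → T p × ¬ T q × Adj G p q
walk-exit G T? here Tu ¬Tv = ⊥-elim (¬Tv Tu)
walk-exit G T? (step {w = w} u~w w⇝v) Tu ¬Tv with T? w
... | yes Tw = walk-exit G T? w⇝v Tw ¬Tv
... | no ¬Tw = _ , w , Tu , ¬Tw , u~w

module _ {n m} {G : Graph (Fin n)} {P : Fin n → Set} (E : Enumeration P m)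
         (closed : ∀ {u v} → P u → Adj G u v → P v) where
  open Enumeration E

  reach-induced : ∀ {u v a b} → Reach G u v → at a ≡ u → at b ≡ v → Reach (induced at G) a b
  reach-induced here            refl b≡a = subst (Reach _ _) (at-injective (sym b≡a)) here
  reach-induced (step u~w w⇝v) refl refl =
    step (subst (Adj G _) (sym (at-index _ Pw)) u~w) (reach-induced w⇝v (at-index _ Pw) refl)
    where Pw = closed (at-satisfies _) u~w

complete⇒≅Complete : ∀ {m} (H : Graph (Fin m)) → IsComplete H → H ≅ Complete m
complete⇒≅Complete H complete =
  ↔-id _ , λ a b → mk⇔ (λ a~b a≡b → irrefl H a (subst (Adj H a) (sym a≡b) a~b)) (complete a b)

VirusAdj⇒≢ : ∀ {t i j} → VirusAdj (suc t) i j → i ≢ j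
VirusAdj⇒≢ (inj₁ (_ , _ , i≢j)) refl = i≢j refl
VirusAdj⇒≢ (inj₂ (inj₁ (i≡t , i≡0))) refl with trans (sym i≡t) i≡0
... | ()
VirusAdj⇒≢ (inj₂ (inj₂ (inj₁ (i≡0 , i≡t)))) refl with trans (sym i≡t) i≡0
... | ()
VirusAdj⇒≢ (inj₂ (inj₂ (inj₂ (inj₁ (i≡1+t , i≡1))))) refl with trans (sym i≡1+t) i≡1
... | ()
VirusAdj⇒≢ (inj₂ (inj₂ (inj₂ (inj₂ (i≡1 , i≡1+t))))) refl with trans (sym i≡1+t) i≡1
... | ()

module _ {V : Set} {t : ℕ} where

  complete⇒virus : ∀ {R : V → V → Set} (h : Fin (suc (suc (suc t))) → V) → Injective _≡_ _≡_ h →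
                   (∀ a b → a ≢ b → R (h a) (h b)) → ContainsVirus (suc t) R
  complete⇒virus h h-injective h-adj = h , h-injective , λ i j i~j → h-adj i j (VirusAdj⇒≢ i~j)

  virus-map : ∀ {W : Set} {R : V → V → Set} {S : W → W → Set} (e : V → W) → Injective _≡_ _≡_ e →
              (∀ {x y} → R x y → S (e x) (e y)) → ContainsVirus t R → ContainsVirus t S
  virus-map e e-injective e-hom (f , f-injective , f-adj) =
    e ∘ f , f-injective ∘ e-injective , λ i j i~j → e-hom (f-adj i j i~j)

virus-pullback : ∀ {t} {V W : Set} {R : W → W → Set} {S : V → V → Set} (e : W → V) →
                 (∀ {x y} → S (e x) (e y) → R x y) → ((f , _) : ContainsVirus t S) →
                 (h : Fin (suc (suc t)) → W) → (∀ i → e (h i) ≡ f i) → ContainsVirus t R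
virus-pullback {S = S} e e-reflects (f , f-injective , f-adj) h e∘h≗f =
  h , (λ {i} {j} hi≡hj → f-injective (trans (sym (e∘h≗f i)) (trans (cong e hi≡hj) (e∘h≗f j)))) ,
  λ i j i~j → e-reflects (subst₂ S (sym (e∘h≗f i)) (sym (e∘h≗f j)) (f-adj i j i~j))

large-complete⇒virus : ∀ {t m} (H : Graph (Fin m)) → IsComplete H → suc (suc (suc t)) ≤ m →
                       ContainsVirus (suc t) (Adj H)
large-complete⇒virus H complete t+2≤m = complete⇒virus {R = Adj H} (λ i → inject≤ i t+2≤m) inject-injective
  λ i j i≢j → complete _ _ (i≢j ∘ inject-injective)
  where
  inject-injective : Injective _≡_ _≡_ (λ i → inject≤ i t+2≤m)
  inject-injective = inject≤-injective _ _ _ _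

module _ {t : ℕ} where

  core-vertex : Fin t → Fin (suc (suc t))
  core-vertex = inject₁ ∘ inject₁

  pendant₀ pendant₁ : Fin (suc (suc t))
  pendant₀ = inject₁ (fromℕ t)
  pendant₁ = fromℕ (suc t)

  toℕ-core-vertex : ∀ a → toℕ (core-vertex a) ≡ toℕ a
  toℕ-core-vertex a = trans (toℕ-inject₁ (inject₁ a)) (toℕ-inject₁ a)

  toℕ-pendant₀ : toℕ pendant₀ ≡ t
  toℕ-pendant₀ = trans (toℕ-inject₁ (fromℕ t)) (toℕ-fromℕ t)

  toℕ-pendant₁ : toℕ pendant₁ ≡ suc t
  toℕ-pendant₁ = toℕ-fromℕ (suc t)

  core-vertex-injective : Injective _≡_ _≡_ core-vertex
  core-vertex-injective {a} {b} eq =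
    toℕ-injective (trans (sym (toℕ-core-vertex a)) (trans (cong toℕ eq) (toℕ-core-vertex b)))

  core-vertex<t : ∀ a → toℕ (core-vertex a) < t
  core-vertex<t a = subst (_< t) (sym (toℕ-core-vertex a)) (toℕ<n a)

  core-adj : ∀ {a b} → a ≢ b → VirusAdj t (core-vertex a) (core-vertex b)
  core-adj {a} {b} a≢b = inj₁ (core-vertex<t a , core-vertex<t b , a≢b ∘ core-vertex-injective ∘ toℕ-injective)

  pendant₀-adj : VirusAdj t pendant₀ zero
  pendant₀-adj = inj₂ (inj₁ (toℕ-pendant₀ , refl))

  pendant₁-adj : VirusAdj t pendant₁ (suc zero)
  pendant₁-adj = inj₂ (inj₂ (inj₂ (inj₁ (toℕ-pendant₁ , refl))))

data Role (t : ℕ) (v : Fin (suc (suc t))) : Set where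
  is-core     : toℕ v < t     → Role t v
  is-pendant₀ : toℕ v ≡ t     → Role t v
  is-pendant₁ : toℕ v ≡ suc t → Role t v

role : ∀ {t} v → Role t v
role {t} v with ℕ.<-cmp (toℕ v) t
... | tri< v<t _ _ = is-core v<t
... | tri≈ _ v≡t _ = is-pendant₀ v≡t
... | tri> _ _ v>t = is-pendant₁ (ℕ.≤-antisym (ℕ.≤-pred (toℕ<n v)) v>t)

virus-connected : ∀ {t} {V L : Set} {R : V → V → Set} (c : V → L) → (∀ {x y} → R x y → c x ≡ c y) →
                  ((f , _) : ContainsVirus (suc (suc t)) R) → ∀ i → c (f i) ≡ c (f zero)
virus-connected c c-const (f , _ , f-adj) i with role i
... | is-pendant₀ i≡t = c-const (f-adj i zero (inj₂ (inj₁ (i≡t , refl))))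
... | is-pendant₁ i≡1+t = trans (c-const (f-adj i (suc zero) (inj₂ (inj₂ (inj₂ (inj₁ (i≡1+t , refl)))))))
                                (c-const (f-adj (suc zero) zero (inj₁ (s≤s (s≤s z≤n) , s≤s z≤n , λ ()))))
... | is-core i<t with toℕ i ℕ.≟ 0
...   | yes i≡0 = cong (c ∘ f) (toℕ-injective {j = zero} i≡0)
...   | no i≢0  = c-const (f-adj i zero (inj₁ (i<t , s≤s z≤n , i≢0)))

new-edge-virus-contains-endpoint : ∀ {t n} {R : Fin n → Fin n → Set} {x y} → ¬ ContainsVirus t R →
                                   ((f , _) : ContainsVirus t (AddEdge R x y)) → ∃ λ i → f i ≡ x
new-edge-virus-contains-endpoint {R = R} {x} virus-free (f , f-injective , f-adj) with any? (λ i → f i ≟ x)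
... | yes found = found
... | no avoids = ⊥-elim (virus-free (f , f-injective , λ i j i~j → old-edge i j (f-adj i j i~j)))
  where
  old-edge : ∀ i j → AddEdge R x _ (f i) (f j) → R (f i) (f j)
  old-edge i j (inj₁ fi~fj)              = fi~fj
  old-edge i j (inj₂ (inj₁ (fi≡x , _))) = ⊥-elim (avoids (i , fi≡x))
  old-edge i j (inj₂ (inj₂ (_ , fj≡x))) = ⊥-elim (avoids (j , fj≡x))

record Clique {V : Set} (G : Graph V) (k : ℕ) : Set where
  field
    vertex           : Fin k → V
    vertex-injective : Injective _≡_ _≡_ vertex
    vertex-adj       : ∀ a b → a ≢ b → Adj G (vertex a) (vertex b)

module _ {V : Set} {G : Graph V} where

  _∈_ : ∀ {k} → V → Clique G k → Set
  v ∈ S = ∃ λ a → Clique.vertex S a ≡ v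

  permute : ∀ {k} → Clique G k → Permutation′ k → Clique G k
  permute S σ = record
    { vertex           = vertex ∘ (σ ⟨$⟩ʳ_)
    ; vertex-injective = σ-injective ∘ vertex-injective
    ; vertex-adj       = λ a b a≢b → vertex-adj _ _ (a≢b ∘ σ-injective) }
    where
    open Clique S
    σ-injective = Injection.injective (↔⇒↣ σ)

  module _ {t : ℕ} (S : Clique G (suc (suc t))) {p q : V}
           (p≢q : p ≢ q) (p∉S : ¬ p ∈ S) (q∉S : ¬ q ∈ S) where
    open Clique S

    private
      place : ∀ {v} → Role (suc (suc t)) v → V
      place (is-core v<t)   = vertex (fromℕ< v<t)
      place (is-pendant₀ _) = p
      place (is-pendant₁ _) = q

      place-core : ∀ {v} (r : Role _ v) a → toℕ v ≡ toℕ a → place r ≡ vertex a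
      place-core (is-core v<t)       a v≡a = cong vertex (toℕ-injective (trans (toℕ-fromℕ< v<t) v≡a))
      place-core (is-pendant₀ v≡t)   a v≡a = ⊥-elim (ℕ.<-irrefl (trans (sym v≡a) v≡t) (toℕ<n a))
      place-core (is-pendant₁ v≡1+t) a v≡a =
        ⊥-elim (ℕ.<-asym (toℕ<n a) (subst (_ <_) (trans (sym v≡1+t) v≡a) (ℕ.n<1+n _)))

      place-pendant₀ : ∀ {v} (r : Role _ v) → toℕ v ≡ suc (suc t) → place r ≡ p
      place-pendant₀ (is-core v<t)      v≡t = ⊥-elim (ℕ.<-irrefl v≡t v<t)
      place-pendant₀ (is-pendant₀ _)    _   = refl
      place-pendant₀ (is-pendant₁ v≡1+t) v≡t = ⊥-elim (ℕ.1+n≢n (trans (sym v≡1+t) v≡t))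

      place-pendant₁ : ∀ {v} (r : Role _ v) → toℕ v ≡ suc (suc (suc t)) → place r ≡ q
      place-pendant₁ (is-core v<t)     v≡1+t = ⊥-elim (ℕ.<-asym v<t (subst (_ <_) (sym v≡1+t) (ℕ.n<1+n _)))
      place-pendant₁ (is-pendant₀ v≡t) v≡1+t = ⊥-elim (ℕ.1+n≢n (trans (sym v≡1+t) v≡t))
      place-pendant₁ (is-pendant₁ _)   _     = refl

      place-injective : ∀ {u v} (r : Role _ u) (s : Role _ v) → place r ≡ place s → u ≡ v
      place-injective (is-core u<t) (is-core v<t) eq =
        toℕ-injective (trans (sym (toℕ-fromℕ< u<t)) (trans (cong toℕ (vertex-injective eq)) (toℕ-fromℕ< v<t)))
      place-injective (is-core _)       (is-pendant₀ _)   eq = ⊥-elim (p∉S (_ , eq))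
      place-injective (is-core _)       (is-pendant₁ _)   eq = ⊥-elim (q∉S (_ , eq))
      place-injective (is-pendant₀ _)   (is-core _)       eq = ⊥-elim (p∉S (_ , sym eq))
      place-injective (is-pendant₀ u≡t) (is-pendant₀ v≡t) _  = toℕ-injective (trans u≡t (sym v≡t))
      place-injective (is-pendant₀ _)   (is-pendant₁ _)   eq = ⊥-elim (p≢q eq)
      place-injective (is-pendant₁ _)   (is-core _)       eq = ⊥-elim (q∉S (_ , sym eq))
      place-injective (is-pendant₁ _)   (is-pendant₀ _)   eq = ⊥-elim (p≢q (sym eq))
      place-injective (is-pendant₁ u≡t) (is-pendant₁ v≡t) _  = toℕ-injective (trans u≡t (sym v≡t))

    attach-pendants : Adj G (vertex zero) p → Adj G (vertex (suc zero)) q → ContainsVirus (suc (suc t)) (Adj G)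
    attach-pendants 0~p 1~q = f , (λ {u} {v} → place-injective (role u) (role v)) , f-adj
      where
      f : Fin (suc (suc (suc (suc t)))) → V
      f v = place (role v)

      f-core : ∀ {v} a → toℕ v ≡ toℕ a → f v ≡ vertex a
      f-core {v} = place-core (role v)

      f-adj : ∀ i j → VirusAdj _ i j → Adj G (f i) (f j)
      f-adj i j (inj₁ (i<t , j<t , i≢j)) =
        subst₂ (Adj G) (sym (f-core _ (sym (toℕ-fromℕ< i<t)))) (sym (f-core _ (sym (toℕ-fromℕ< j<t))))
          (vertex-adj _ _ λ eq → i≢j (trans (sym (toℕ-fromℕ< i<t)) (trans (cong toℕ eq) (toℕ-fromℕ< j<t))))
      f-adj i j (inj₂ (inj₁ (i≡t , j≡0))) =
        subst₂ (Adj G) (sym (place-pendant₀ (role i) i≡t)) (sym (f-core zero j≡0)) (adj-sym G 0~p)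
      f-adj i j (inj₂ (inj₂ (inj₁ (i≡0 , j≡t)))) =
        subst₂ (Adj G) (sym (f-core zero i≡0)) (sym (place-pendant₀ (role j) j≡t)) 0~p
      f-adj i j (inj₂ (inj₂ (inj₂ (inj₁ (i≡1+t , j≡1))))) =
        subst₂ (Adj G) (sym (place-pendant₁ (role i) i≡1+t)) (sym (f-core (suc zero) j≡1)) (adj-sym G 1~q)
      f-adj i j (inj₂ (inj₂ (inj₂ (inj₂ (i≡1 , j≡1+t))))) =
        subst₂ (Adj G) (sym (f-core (suc zero) i≡1)) (sym (place-pendant₁ (role j) j≡1+t)) 1~q

  pendants⇒virus : ∀ {t} (S : Clique G (suc (suc t))) {i j} → i ≢ j → ∀ {p q} → p ≢ q → ¬ p ∈ S → ¬ q ∈ S →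
                   Adj G (Clique.vertex S i) p → Adj G (Clique.vertex S j) q → ContainsVirus (suc (suc t)) (Adj G)
  pendants⇒virus S {i} {j} i≢j p≢q p∉S q∉S i~p j~q =
    attach-pendants (permute S σ) p≢q (p∉S ∘ unpermute) (q∉S ∘ unpermute)
      i~p (subst (λ a → Adj G (Clique.vertex S a) _) (sym (punchIn-punchOut i≢j)) j~q)
    where
    -- σ 0 = i and σ 1 = j
    σ = insert zero i (insert zero (punchOut i≢j) id)

    unpermute : ∀ {v} → v ∈ permute S σ → v ∈ S
    unpermute (a , eq) = σ ⟨$⟩ʳ a , eq

module PendantCliques {n : ℕ} (k : ℕ) (G : Graph (Fin n)) (virus-free : ¬ ContainsVirus (suc (suc k)) (Adj G)) where

  t : ℕ
  t = suc (suc k)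

  _∈?_ : ∀ v (S : Clique G t) → Dec (v ∈ S)
  v ∈? S = any? λ a → Clique.vertex S a ≟ v

  record PendantClique (x : Fin n) : Set where
    field
      clique      : Clique G t
      home hook   : Fin t
      home≢hook   : home ≢ hook
      at-home     : Clique.vertex clique home ≡ x
      leaf        : Fin n
      leaf∉clique : ¬ leaf ∈ clique
      hook~leaf   : Adj G (Clique.vertex clique hook) leaf

    span : Fin (suc t) → Fin n
    span zero    = leaf
    span (suc a) = Clique.vertex clique a

    span-injective : Injective _≡_ _≡_ span
    span-injective {zero}  {zero}  _  = refl
    span-injective {zero}  {suc b} eq = ⊥-elim (leaf∉clique (b , sym eq))
    span-injective {suc a} {zero}  eq = ⊥-elim (leaf∉clique (a , eq))
    span-injective {suc a} {suc b} eq = cong suc (Clique.vertex-injective clique eq)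

  pendants-coincide : ∀ (S : Clique G t) {a b} → a ≢ b → ∀ {p q} → ¬ p ∈ S → ¬ q ∈ S →
                      Adj G (Clique.vertex S a) p → Adj G (Clique.vertex S b) q → p ≡ q
  pendants-coincide S a≢b p∉S q∉S a~p b~q =
    decidable-stable (_ ≟ _) λ p≢q → virus-free (pendants⇒virus S a≢b p≢q p∉S q∉S a~p b~q)

  -- A pendant clique at u that meets B lies inside B + u, so w and its leaf would be distinct
  -- pendants of it; one that misses B has r and its leaf as distinct pendants.
  gate⇒¬pendantClique : ∀ {B : Fin n → Set} → Decidable B → ∀ {u} →
                        (∀ {b v} → B b → Adj G b v → B v ⊎ v ≡ u) →
                        ∀ {r w} → B r → Adj G u r → ¬ B w → w ≢ u → Adj G u w → ¬ PendantClique u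
  gate⇒¬pendantClique {B} B? {u} closed {r} {w} Br u~r ¬Bw w≢u u~w P = meets-or-misses (any? (B? ∘ vertex))
    where
    open PendantClique P
    open Clique clique

    home~ : ∀ {v} → Adj G u v → Adj G (vertex home) v
    home~ = subst (λ x → Adj G x _) (sym at-home)

    hook≢u : vertex hook ≢ u
    hook≢u hook≡u = home≢hook (vertex-injective (trans at-home (sym hook≡u)))

    meets-or-misses : Dec (∃ λ a → B (vertex a)) → ⊥
    meets-or-misses (yes (a , Ba)) = [ ¬Bw , w≢u ] (closed hook-in-B (subst (Adj G _) (sym w≡leaf) hook~leaf))
      where
      inside : ∀ c → B (vertex c) ⊎ vertex c ≡ u
      inside c with c ≟ a
      ... | yes refl = inj₁ Ba
      ... | no c≢a   = closed Ba (vertex-adj a c (c≢a ∘ sym))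

      hook-in-B : B (vertex hook)
      hook-in-B = [ (λ B-hook → B-hook) , ⊥-elim ∘ hook≢u ] (inside hook)

      w≡leaf : w ≡ leaf
      w≡leaf = pendants-coincide clique home≢hook (λ (c , c≡w) → [ ¬Bw , w≢u ] (subst _ c≡w (inside c)))
                 leaf∉clique (home~ u~w) hook~leaf
    meets-or-misses (no disjoint) =
      [ disjoint ∘ (hook ,_) , hook≢u ] (closed Br (adj-sym G (subst (Adj G _) (sym r≡leaf) hook~leaf)))
      where
      r≡leaf : r ≡ leaf
      r≡leaf = pendants-coincide clique home≢hook (λ (c , c≡r) → disjoint (c , subst B (sym c≡r) Br))
                 leaf∉clique (home~ u~r) hook~leaf

  module _ {x} (P : PendantClique x) where
    open PendantClique P
    open Clique clique

    private
      y : Fin n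
      y = vertex hook

      x~y : Adj G x y
      x~y = subst (λ v → Adj G v y) at-home (vertex-adj home hook home≢hook)

    x⇝span : ∀ r → Reach G x (span r)
    x⇝span zero = step x~y (step hook~leaf here)
    x⇝span (suc a) with a ≟ home
    ... | yes refl = subst (Reach G x) (sym at-home) here
    ... | no a≢home = step (subst (λ v → Adj G v _) at-home (vertex-adj home a (a≢home ∘ sym))) here

    second-leaf⇒¬pendantClique : ∀ {w} → ¬ w ∈ clique → w ≢ leaf → Adj G y w → ¬ PendantClique y
    second-leaf⇒¬pendantClique {w} w∉S w≢leaf y~w =
      gate⇒¬pendantClique B? closed (home , home≢hook , at-home) (adj-sym G x~y)
        (λ (a , _ , a≡w) → w∉S (a , a≡w)) (λ w≡y → w∉S (hook , sym w≡y)) y~w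
      where
      B : Fin n → Set
      B v = ∃ λ a → a ≢ hook × vertex a ≡ v

      B? : Decidable B
      B? v = any? λ a → ¬? (a ≟ hook) ×-dec (vertex a ≟ v)

      closed : ∀ {b v} → B b → Adj G b v → B v ⊎ v ≡ y
      closed {v = v} (a , a≢hook , refl) a~v with v ∈? clique
      ... | yes (c , refl) with c ≟ hook
      ...   | yes refl   = inj₂ refl
      ...   | no c≢hook  = inj₁ (c , c≢hook , refl)
      closed {v = v} (a , a≢hook , refl) a~v | no v∉S =
        ⊥-elim (w≢leaf (trans (sym (pendants-coincide clique a≢hook v∉S w∉S a~v y~w))
                              (pendants-coincide clique a≢hook v∉S leaf∉clique a~v hook~leaf)))

    sole-leaf⇒¬pendantClique : (∀ {w} → ¬ w ∈ clique → Adj G y w → w ≡ leaf) →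
                               (g : Fin (suc (suc t)) → Fin n) → Injective _≡_ _≡_ g → (∀ i → Reach G x (g i)) →
                               ¬ PendantClique leaf
    sole-leaf⇒¬pendantClique sole g g-injective x⇝g =
      let w , w∉S , w≢leaf , leaf~w = escape
      in gate⇒¬pendantClique (_∈? clique) closed (hook , refl) (adj-sym G hook~leaf) w∉S w≢leaf leaf~w
      where
      closed : ∀ {b v} → b ∈ clique → Adj G b v → v ∈ clique ⊎ v ≡ leaf
      closed {v = v} (a , refl) a~v with v ∈? clique
      ... | yes v∈S = inj₁ v∈S
      ... | no v∉S with a ≟ hook
      ...   | yes refl   = inj₂ (sole v∉S a~v)
      ...   | no a≢hook  = inj₂ (pendants-coincide clique a≢hook v∉S leaf∉clique a~v hook~leaf)

      escape : ∃ λ w → ¬ w ∈ clique × w ≢ leaf × Adj G leaf w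
      escape with outside-image span g g-injective (ℕ.n<1+n _)
      ... | i , g-outside with walk-exit G (λ v → any? λ r → span r ≟ v)
                                 (step (adj-sym G hook~leaf) (step (adj-sym G x~y) (x⇝g i)))
                                 (zero , refl) (λ (r , eq) → g-outside r eq)
      ... | _ , w , (zero , refl) , ¬Sw , leaf~w =
        w , (λ (a , eq) → ¬Sw (suc a , eq)) , (λ eq → ¬Sw (zero , sym eq)) , leaf~w
      ... | _ , w , (suc a , refl) , ¬Sw , a~w =
        ⊥-elim (¬Sw ([ (λ (c , eq) → suc c , eq) , (λ eq → zero , sym eq) ] (closed (a , refl) a~w)))

    large-component⇒non-pendant : (g : Fin (suc (suc t)) → Fin n) → Injective _≡_ _≡_ g →
                                  (∀ i → Reach G x (g i)) → ∃ λ v → Reach G x v × ¬ PendantClique v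
    large-component⇒non-pendant g g-injective x⇝g
      with any? (λ w → ¬? (w ∈? clique) ×-dec ¬? (w ≟ leaf) ×-dec adj? G y w)
    ... | yes (w , w∉S , w≢leaf , y~w) = y , step x~y here , second-leaf⇒¬pendantClique w∉S w≢leaf y~w
    ... | no no-second-leaf = leaf , x⇝span zero ,
      sole-leaf⇒¬pendantClique
        (λ w∉S y~w → decidable-stable (_ ≟ _) λ w≢leaf → no-second-leaf (_ , w∉S , w≢leaf , y~w))
        g g-injective x⇝g

third : ∀ {k} (a b : Fin (suc (suc (suc k)))) → ∃ λ d → d ≢ a × d ≢ b
third zero          zero          = suc zero , (λ ()) , (λ ())
third zero          (suc zero)    = suc (suc zero) , (λ ()) , (λ ())
third zero          (suc (suc _)) = suc zero , (λ ()) , (λ ())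
third (suc zero)    zero          = suc (suc zero) , (λ ()) , (λ ())
third (suc zero)    (suc _)       = zero , (λ ()) , (λ ())
third (suc (suc _)) zero          = suc zero , (λ ()) , (λ ())
third (suc (suc _)) (suc _)       = zero , (λ ()) , (λ ())

module _ {n k : ℕ} (G : Graph (Fin n)) (virus-free : ¬ ContainsVirus (suc (suc (suc k))) (Adj G)) where
  open PendantCliques (suc k) G virus-free

  -- The core of the virus avoids uv, as a third core vertex would be a common neighbour of u and v.
  -- Not both pendant edges avoid uv (the virus would lie in G); the one that is uv ends on the core at u or v.
  new-edge-virus⇒pendantClique : ∀ {u v} → (∀ w → Adj G w u → Adj G w v → ⊥) →
                                 ContainsVirus t (AddEdge (Adj G) u v) → PendantClique u ⊎ PendantClique v
  new-edge-virus⇒pendantClique {u} {v} no-common-neighbour (f , f-injective , f-adj) =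
    classify (f-adj pendant₀ zero pendant₀-adj) (f-adj pendant₁ (suc zero) pendant₁-adj)
    where
    Endpoints : Fin n → Fin n → Set
    Endpoints p q = (p ≡ u × q ≡ v) ⊎ (p ≡ v × q ≡ u)

    off-endpoints : ∀ {p q r} → Endpoints p q → r ≢ p → r ≢ q → r ≢ u × r ≢ v
    off-endpoints (inj₁ (refl , refl)) r≢p r≢q = r≢p , r≢q
    off-endpoints (inj₂ (refl , refl)) r≢p r≢q = r≢q , r≢p

    old-edge : ∀ {p q} → AddEdge (Adj G) u v p q → p ≢ u × p ≢ v → Adj G p q
    old-edge (inj₁ p~q)                _            = p~q
    old-edge (inj₂ (inj₁ (p≡u , _))) (p≢u , _)   = ⊥-elim (p≢u p≡u)
    old-edge (inj₂ (inj₂ (p≡v , _))) (_ , p≢v)   = ⊥-elim (p≢v p≡v)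

    no-common-endpoint-neighbour : ∀ {p q r} → Endpoints p q → Adj G r p → Adj G r q → ⊥
    no-common-endpoint-neighbour (inj₁ (refl , refl)) r~p r~q = no-common-neighbour _ r~p r~q
    no-common-endpoint-neighbour (inj₂ (refl , refl)) r~p r~q = no-common-neighbour _ r~q r~p

    f-≢ : ∀ {i j} → i ≢ j → f i ≢ f j
    f-≢ i≢j = i≢j ∘ f-injective

    core-edge : ∀ a b → a ≢ b → Adj G (f (core-vertex a)) (f (core-vertex b))
    core-edge a b a≢b with f-adj _ _ (core-adj a≢b)
    ... | inj₁ old = old
    ... | inj₂ ends with third a b
    ...   | d , d≢a , d≢b = ⊥-elim (no-common-endpoint-neighbour ends (edge-from-d a d≢a) (edge-from-d b d≢b))
      where
      edge-from-d : ∀ c → d ≢ c → Adj G (f (core-vertex d)) (f (core-vertex c))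
      edge-from-d c d≢c = old-edge (f-adj _ _ (core-adj d≢c))
        (off-endpoints ends (f-≢ (d≢a ∘ core-vertex-injective)) (f-≢ (d≢b ∘ core-vertex-injective)))

    core : Clique G t
    core = record
      { vertex = f ∘ core-vertex ; vertex-injective = core-vertex-injective ∘ f-injective ; vertex-adj = core-edge }

    off-core : ∀ {ℓ} → t ≤ toℕ ℓ → ¬ f ℓ ∈ core
    off-core {ℓ} t≤ℓ (a , eq) =
      ℕ.<-irrefl refl (ℕ.<-≤-trans (core-vertex<t a) (subst (λ i → t ≤ toℕ i) (sym (f-injective eq)) t≤ℓ))

    t≤pendant₀ : t ≤ toℕ (pendant₀ {t})
    t≤pendant₀ = ℕ.≤-reflexive (sym toℕ-pendant₀)

    t≤pendant₁ : t ≤ toℕ (pendant₁ {t})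
    t≤pendant₁ = ℕ.≤-trans (ℕ.n≤1+n t) (ℕ.≤-reflexive (sym toℕ-pendant₁))

    pendantClique-at : ∀ h k → h ≢ k → ∀ ℓ → t ≤ toℕ ℓ → Adj G (f (core-vertex k)) (f ℓ) →
                       PendantClique (f (core-vertex h))
    pendantClique-at h k h≢k ℓ t≤ℓ k~ℓ = record
      { clique = core ; home = h ; hook = k ; home≢hook = h≢k ; at-home = refl
      ; leaf = f ℓ ; leaf∉clique = off-core t≤ℓ ; hook~leaf = k~ℓ }

    at-endpoint : ∀ {p q} → Endpoints p q → PendantClique q → PendantClique u ⊎ PendantClique v
    at-endpoint (inj₁ (_ , refl)) = inj₂
    at-endpoint (inj₂ (_ , refl)) = inj₁

    classify : AddEdge (Adj G) u v (f pendant₀) (f zero) → AddEdge (Adj G) u v (f pendant₁) (f (suc zero)) →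
               PendantClique u ⊎ PendantClique v
    classify (inj₁ p₀~0) (inj₁ p₁~1) = ⊥-elim (virus-free
      (pendants⇒virus core (λ ()) (f-≢ (fromℕ≢inject₁ ∘ sym)) (off-core t≤pendant₀) (off-core t≤pendant₁)
        (adj-sym G p₀~0) (adj-sym G p₁~1)))
    classify (inj₂ ends) p₁≈1 = at-endpoint ends (pendantClique-at zero (suc zero) (λ ()) pendant₁ t≤pendant₁
      (adj-sym G (old-edge p₁≈1 (off-endpoints ends (f-≢ fromℕ≢inject₁) (f-≢ λ ())))))
    classify (inj₁ p₀~0) (inj₂ ends) = at-endpoint ends (pendantClique-at (suc zero) zero (λ ()) pendant₀ t≤pendant₀
      (adj-sym G p₀~0))

module _ {n L m s : ℕ} (G : Graph (Fin n)) (label : Fin n → Fin (suc L))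
         (adj⇒same-label : ∀ {u v} → Adj G u v → label u ≡ label v)
         {i₀ : Fin (suc L)} (E₀ : Enumeration (λ v → label v ≡ i₀) m)
         (E : ∀ j → Enumeration (λ v → label v ≡ punchIn i₀ j) s)
         (E-complete : ∀ j → IsComplete (induced (Enumeration.at (E j)) G)) where

  private
    open Enumeration using (at; index; at-index; index-at; at-injective; at-satisfies)

    H = induced (at E₀) G ∪ Copies L (Complete s)

    other : ∀ v → label v ≢ i₀ → Fin L
    other v v∉i₀ = punchOut (v∉i₀ ∘ sym)

    in-other : ∀ v v∉i₀ → label v ≡ punchIn i₀ (other v v∉i₀)
    in-other v v∉i₀ = sym (punchIn-punchOut (v∉i₀ ∘ sym))

    position : ∀ v v∉i₀ → Fin s
    position v v∉i₀ = index (E (other v v∉i₀)) v (in-other v v∉i₀)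

    at-position : ∀ v v∉i₀ → at (E (other v v∉i₀)) (position v v∉i₀) ≡ v
    at-position v v∉i₀ = at-index (E (other v v∉i₀)) v (in-other v v∉i₀)

    encode : ∀ v → Dec (label v ≡ i₀) → Fin m ⊎ (Fin L × Fin s)
    encode v (yes v∈i₀) = inj₁ (index E₀ v v∈i₀)
    encode v (no v∉i₀)  = inj₂ (other v v∉i₀ , position v v∉i₀)

    decode : Fin m ⊎ (Fin L × Fin s) → Fin n
    decode (inj₁ a)       = at E₀ a
    decode (inj₂ (j , r)) = at (E j) r

    decode-encode : ∀ v d → decode (encode v d) ≡ v
    decode-encode v (yes v∈i₀) = at-index E₀ v v∈i₀
    decode-encode v (no v∉i₀)  = at-position v v∉i₀

    reindex : ∀ j j′ r → j′ ≡ j → (p : label (at (E j) r) ≡ punchIn i₀ j′) →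
              (j′ , index (E j′) _ p) ≡ (j , r)
    reindex j .j r refl p = cong (j ,_) (index-at (E j) r p)

    encode-decode : ∀ w d → encode (decode w) d ≡ w
    encode-decode (inj₁ a)       (yes _)    = cong inj₁ (index-at E₀ a _)
    encode-decode (inj₁ a)       (no ∉i₀)   = ⊥-elim (∉i₀ (at-satisfies E₀ a))
    encode-decode (inj₂ (j , r)) (yes ∈i₀)  = ⊥-elim (punchInᵢ≢i i₀ j (trans (sym (at-satisfies (E j) r)) ∈i₀))
    encode-decode (inj₂ (j , r)) (no ∉i₀)   = cong inj₂ (reindex j _ r
      (trans (punchOut-cong i₀ (at-satisfies (E j) r)) (punchOut-punchIn i₀)) (in-other _ ∉i₀))

    adj-preserved : ∀ x y dx dy → Adj G x y ⇔ Adj H (encode x dx) (encode y dy)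
    adj-preserved x y (yes x∈i₀) (yes y∈i₀) =
      mk⇔ (subst₂ (Adj G) (sym (at-index E₀ x x∈i₀)) (sym (at-index E₀ y y∈i₀)))
          (subst₂ (Adj G) (at-index E₀ x x∈i₀) (at-index E₀ y y∈i₀))
    adj-preserved x y (yes x∈i₀) (no y∉i₀) = mk⇔ (λ x~y → y∉i₀ (trans (sym (adj⇒same-label x~y)) x∈i₀)) λ ()
    adj-preserved x y (no x∉i₀)  (yes y∈i₀) = mk⇔ (λ x~y → x∉i₀ (trans (adj⇒same-label x~y) y∈i₀)) λ ()
    adj-preserved x y (no x∉i₀)  (no y∉i₀)  = mk⇔ forth back
      where
      forth : Adj G x y → Adj H (encode x (no x∉i₀)) (encode y (no y∉i₀))
      forth x~y = same-other , λ same-position → irrefl G x (subst (Adj G x) (sym (x≡y same-position)) x~y)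
        where
        same-other : other x x∉i₀ ≡ other y y∉i₀
        same-other = punchOut-cong i₀ (adj⇒same-label x~y)

        x≡y : position x x∉i₀ ≡ position y y∉i₀ → x ≡ y
        x≡y same-position = trans (sym (at-position x x∉i₀))
          (trans (cong₂ (λ j r → at (E j) r) same-other same-position) (at-position y y∉i₀))

      back : Adj H (encode x (no x∉i₀)) (encode y (no y∉i₀)) → Adj G x y
      back (same-other , different-position) =
        subst₂ (Adj G) (at-position x x∉i₀)
          (trans (cong (λ j → at (E j) (position y y∉i₀)) same-other) (at-position y y∉i₀))
          (E-complete (other x x∉i₀) _ _ different-position)

  split-off-cliques : G ≅ (induced (Enumeration.at E₀) G ∪ Copies L (Complete s))
  split-off-cliques =
    mk↔ₛ′ (λ v → encode v (label v ≟ i₀)) decode (λ w → encode-decode w (label (decode w) ≟ i₀))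
          (λ v → decode-encode v (label v ≟ i₀)) ,
    λ x y → adj-preserved x y (label x ≟ i₀) (label y ≟ i₀)

module Components {n k l : ℕ} (G : Graph (Fin n)) (saturated : Saturated (suc (suc (suc k))) G)
                  (components : HasComponents G l) where

  label : Fin n → Fin l
  label = proj₁ components

  private
    virus-free = proj₁ (proj₂ saturated)
    saturating = proj₂ (proj₂ saturated)
    inhabited  = proj₁ (proj₂ components)
    same⇔reach = proj₂ (proj₂ components)

  open PendantCliques (suc k) G virus-free public

  same-label⇒reach : ∀ {u v} → label u ≡ label v → Reach G u v
  same-label⇒reach = Equivalence.to (same⇔reach _ _)

  reach⇒same-label : ∀ {u v} → Reach G u v → label u ≡ label v
  reach⇒same-label = Equivalence.from (same⇔reach _ _)

  adj⇒same-label : ∀ {u v} → Adj G u v → label u ≡ label v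
  adj⇒same-label u~v = reach⇒same-label (step u~v here)

  order : Fin l → ℕ
  order j = proj₁ (enumerate (λ v → label v ≟ j))

  component : ∀ j → Enumeration (λ v → label v ≡ j) (order j)
  component j = proj₂ (enumerate (λ v → label v ≟ j))

  componentGraph : ∀ j → Graph (Fin (order j))
  componentGraph j = induced (Enumeration.at (component j)) G

  order-positive : ∀ j → 1 ≤ order j
  order-positive j = >-nonZero⁻¹ _ {{nonZeroIndex (Enumeration.index (component j) _ (proj₂ (inhabited j)))}}

  virus-in-component : ∀ {x y} → label x ≡ label y → ((f , _) : ContainsVirus t (AddEdge (Adj G) x y)) →
                       ∀ i → label (f i) ≡ label x
  virus-in-component {x} {y} x≈y V i =
    let i₀ , fi₀≡x = new-edge-virus-contains-endpoint {R = Adj G} virus-free V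
    in trans (connected i) (trans (sym (connected i₀)) (cong label fi₀≡x))
    where
    new-edge-same-label : ∀ {p q} → AddEdge (Adj G) x y p q → label p ≡ label q
    new-edge-same-label (inj₁ p~q)               = adj⇒same-label p~q
    new-edge-same-label (inj₂ (inj₁ (refl , refl))) = x≈y
    new-edge-same-label (inj₂ (inj₂ (refl , refl))) = sym x≈y

    connected = virus-connected {R = AddEdge (Adj G) x y} label new-edge-same-label V

  pendantClique⇒order : ∀ {x} → PendantClique x → suc t ≤ order (label x)
  pendantClique⇒order {x} P = injective⇒≤ {f = λ r → index (span r) (in-component r)} λ {r} {s} eq →
    span-injective (trans (sym (at-index _ (in-component r))) (trans (cong at eq) (at-index _ (in-component s))))
    where
    open PendantClique P
    open Enumeration (component (label x))

    in-component : ∀ r → label (span r) ≡ label x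
    in-component r = sym (reach⇒same-label (x⇝span P r))

  CompleteEnumeration : Fin l → ℕ → Set
  CompleteEnumeration j m =
    Σ (Enumeration (λ v → label v ≡ j) m) λ E → IsComplete (induced (Enumeration.at E) G)

  IsCliqueComponent : Fin l → Set
  IsCliqueComponent j = IsComplete (componentGraph j) × order j ≡ suc t

  isCliqueComponent? : Decidable IsCliqueComponent
  isCliqueComponent? j = complete? (componentGraph j) ×-dec (order j ℕ.≟ suc t)

  cliqueComponent : ∀ j → IsCliqueComponent j → CompleteEnumeration j (suc t)
  cliqueComponent j (complete , exact) = subst (CompleteEnumeration j) exact (component j , complete)

  component-saturating : ∀ j a b → a ≢ b → ¬ Adj (componentGraph j) a b →
                         ContainsVirus t (AddEdge (Adj (componentGraph j)) a b)
  component-saturating j a b a≢b a≁b =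
    virus-pullback {S = AddEdge (Adj G) (at a) (at b)} at reflect V
      (λ i → index _ (in-j i)) (λ i → at-index _ (in-j i))
    where
    open Enumeration (component j)

    V = saturating (at a) (at b) (a≢b ∘ at-injective) a≁b

    in-j : ∀ i → label (proj₁ V i) ≡ j
    in-j i = trans (virus-in-component (trans (at-satisfies a) (sym (at-satisfies b))) V i) (at-satisfies a)

    reflect : ∀ {x y} → AddEdge (Adj G) (at a) (at b) (at x) (at y) → AddEdge (Adj (componentGraph j)) a b x y
    reflect (inj₁ x~y)                = inj₁ x~y
    reflect (inj₂ (inj₁ (x≡a , y≡b))) = inj₂ (inj₁ (at-injective x≡a , at-injective y≡b))
    reflect (inj₂ (inj₂ (x≡b , y≡a))) = inj₂ (inj₂ (at-injective x≡b , at-injective y≡a))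

  component-virus-free : ∀ j → ¬ ContainsVirus t (Adj (componentGraph j))
  component-virus-free j =
    virus-free ∘ virus-map {R = Adj (componentGraph j)} {S = Adj G} at at-injective λ x~y → x~y
    where open Enumeration (component j)

  complete-component-order : ∀ j → IsComplete (componentGraph j) → order j ≤ suc t
  complete-component-order j complete =
    ℕ.≮⇒≥ (component-virus-free j ∘ large-complete⇒virus (componentGraph j) complete)

  -- Doubly negated: membership in a pendant clique is not decided.
  non-clique⇒non-pendant : ∀ j → ¬ IsCliqueComponent j → ¬ ¬ ∃ λ v → label v ≡ j × ¬ PendantClique v
  non-clique⇒non-pendant j not-clique no-witness with complete? (componentGraph j)
  ... | yes complete with ℕ.<-cmp (order j) (suc t)
  ...   | tri< small _ _ =
    no-witness (v , v∈j , λ P → ℕ.<⇒≱ small (subst (λ i → suc t ≤ order i) v∈j (pendantClique⇒order P)))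
    where
    v = proj₁ (inhabited j)
    v∈j = proj₂ (inhabited j)
  ...   | tri≈ _ exact _ = not-clique (complete , exact)
  ...   | tri> _ _ large = ℕ.<⇒≱ large (complete-component-order j complete)
  non-clique⇒non-pendant j not-clique no-witness | no incomplete with nonadjacent-pair (componentGraph j) incomplete
  ... | a , b , a≢b , a≁b = no-witness (at a , at-satisfies a , λ P → no-witness (escape P))
    where
    open Enumeration (component j)

    V = saturating (at a) (at b) (a≢b ∘ at-injective) a≁b

    a≈b : label (at a) ≡ label (at b)
    a≈b = trans (at-satisfies a) (sym (at-satisfies b))

    escape : PendantClique (at a) → ∃ λ v → label v ≡ j × ¬ PendantClique v
    escape P =
      let v , a⇝v , ¬Pv = large-component⇒non-pendant P (proj₁ V) (proj₁ (proj₂ V))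
                            (λ i → same-label⇒reach (sym (virus-in-component a≈b V i)))
      in v , trans (sym (reach⇒same-label a⇝v)) (at-satisfies a) , ¬Pv

  non-clique-components-coincide : ∀ i j → i ≢ j → ¬ IsCliqueComponent i → ¬ IsCliqueComponent j → ⊥
  non-clique-components-coincide i j i≢j ¬Ki ¬Kj =
    non-clique⇒non-pendant i ¬Ki λ (u , u∈i , ¬Pu) →
    non-clique⇒non-pendant j ¬Kj λ (v , v∈j , ¬Pv) →
    let u≉v : label u ≢ label v
        u≉v u≈v = i≢j (trans (sym u∈i) (trans u≈v v∈j))
    in [ ¬Pu , ¬Pv ] (new-edge-virus⇒pendantClique G virus-free
         (λ w w~u w~v → u≉v (trans (sym (adj⇒same-label w~u)) (adj⇒same-label w~v)))
         (saturating u v (u≉v ∘ cong label) (u≉v ∘ adj⇒same-label)))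

  component-connected : ∀ j → Connected (componentGraph j)
  component-connected j = order-positive j , λ a b →
    reach-induced (component j) (λ u∈j u~v → trans (sym (adj⇒same-label u~v)) u∈j)
      (same-label⇒reach (trans (at-satisfies a) (sym (at-satisfies b)))) refl refl
    where open Enumeration (component j)

  component-saturated-or-complete : ∀ j → Saturated t (componentGraph j)
                                      ⊎ (1 ≤ order j × order j ≤ suc t × (componentGraph j ≅ Complete (order j)))
  component-saturated-or-complete j with complete? (componentGraph j)
  ... | yes complete = inj₂ (order-positive j , complete-component-order j complete ,
                             complete⇒≅Complete (componentGraph j) complete)
  ... | no incomplete with nonadjacent-pair (componentGraph j) incomplete
  ...   | a , b , a≢b , a≁b = inj₁ (injective⇒≤ (proj₁ (proj₂ (component-saturating j a b a≢b a≁b))) ,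
                                   component-virus-free j , component-saturating j)

lemma2p3 : (t n l : ℕ) → 4 ≤ t → (G : Graph (Fin n)) → Saturated t G
    → HasComponents G l → 2 ≤ l
    → Σ ℕ λ m → Σ (Graph (Fin m)) λ G₁ →
        Connected G₁
        × (G ≅ (G₁ ∪ Copies (l ∸ 1) (Complete (suc t))))
        × (Saturated t G₁ ⊎ (1 ≤ m × m ≤ suc t × (G₁ ≅ Complete m)))
lemma2p3 .(suc (suc (suc k))) n .(suc L) (s≤s (s≤s (s≤s {n = k} _))) G saturated components (s≤s {n = L} _) =
  order i₀ , componentGraph i₀ , component-connected i₀ ,
  split-off-cliques G label adj⇒same-label (component i₀) (proj₁ ∘ clique) (proj₂ ∘ clique) ,
  component-saturated-or-complete i₀
  where
  open Components G saturated components

  exceptional = all-but-one isCliqueComponent? non-clique-components-coincide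
  i₀ = proj₁ exceptional

  clique : ∀ j → CompleteEnumeration (punchIn i₀ j) (suc t)
  clique j = cliqueComponent (punchIn i₀ j) (proj₂ exceptional (punchIn i₀ j) (punchInᵢ≢i i₀ j))
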